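{- Let $P$ be a finite poset. Then the poset $S_N(S_N(P))$ is $N$-free. Moreover, it is the smallest $N$-free poset coming from a barycentric subdivision of $Diag(P)$: $S_N(S_N(P))$ is itself a barycentric subdivision of $Diag(P)$, and for every barycentric subdivision $Q$ of $Diag(P)$ that is $N$-free, every edge of $Diag(P)$ on which a vertex is added in forming $S_N(S_N(P))$ also receives at least one added vertex in $Q$ (so $S_N(S_N(P))$ embeds in $Q$ by a map fixing $P$).
   Context: For a poset $P$, a covering pair is $(x,y)$ with $x<y$ and no $z$ with $x<z<y$; write $x\prec y$. $Diag(P)$ is the directed graph on $P$ whose edges are the covering pairs. $Inc(P)$ is the set of pairs of incomparable elements. Four elements $a,b,c,d\in P$ form an $N$ in $P$ if $b\prec c$, $a\prec c$, $b\prec d$ and $(a,d)\in Inc(P)$; the pair $(b,c)$ is then called the diagonal edge of this $N$. $P$ is $N$-free if it contains no $N$. $N_{diag}(P)$ denotes the set of diagonal edges of all $N$'s in $P$. A barycentric subdivision of $Diag(P)$ is obtained by adding finitely many (possibly zero) new vertices on each edge of $Diag(P)$, i.e. replacing each edge $(x,y)$ by a path $x\prec u_1\prec\cdots\prec u_k\prec y$ of new vertices; the resulting poset is the reflexive-transitive closure of the new diagram, and it contains $P$ as an induced subposet. $S_N(P)$ is the poset obtained from $P$ by adding exactly one new (dummy) vertex on each edge in $N_{diag}(P)$ and no vertex on the other edges. -}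

module Defs where

open import Level using (0ℓ)
open import Data.Nat using (ℕ; zero; suc)
open import Data.Fin using (Fin; toℕ)
open import Data.Product using (Σ; _×_; _,_)
open import Data.Irrelevant using (Irrelevant)
open import Relation.Nullary using (¬_)
open import Relation.Binary.PropositionalEquality using (_≡_; _≢_)
open import Relation.Binary.Construct.Closure.ReflexiveTransitive using (Star)

-- A carrier with an order relation (for us always a partial order).
record OrdStr : Set₁ where
  field
    Car : Set
    _≤_ : Car → Car → Set

module _ (A : OrdStr) where
  open OrdStr A

  Lt : Car → Car → Set
  Lt x y = (x ≤ y) × (x ≢ y)

  Covers : Car → Car → Set
  Covers x y = Lt x y × ¬ (Σ Car λ z → Lt x z × Lt z y)

  Inc : Car → Car → Set
  Inc x y = ¬ (x ≤ y) × ¬ (y ≤ x)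

  -- a, b, c, d form an N (diagonal edge (b , c))
  IsN : Car → Car → Car → Car → Set
  IsN a b c d = Covers b c × Covers a c × Covers b d × Inc a d

  NDiag : Car → Car → Set
  NDiag b c = Σ Car λ a → Σ Car λ d → IsN a b c d

  NFree : Set
  NFree = ∀ a b c d → ¬ IsN a b c d

-- Barycentric subdivision of Diag(A) adding k x y new vertices on each
-- covering edge (x , y) (values of k on non-edges are irrelevant).
module _ (A : OrdStr) (k : OrdStr.Car A → OrdStr.Car A → ℕ) where
  open OrdStr A

  data SubVert : Set where
    old : Car → SubVert
    new : (x y : Car) → Irrelevant (Covers A x y) → Fin (k x y) → SubVert

  data SubEdge : SubVert → SubVert → Set where
    direct : ∀ {x y} → Covers A x y → k x y ≡ 0 → SubEdge (old x) (old y)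
    first  : ∀ {x y} s (i : Fin (k x y)) → toℕ i ≡ 0 →
             SubEdge (old x) (new x y s i)
    step   : ∀ {x y} s (i j : Fin (k x y)) → suc (toℕ i) ≡ toℕ j →
             SubEdge (new x y s i) (new x y s j)
    last   : ∀ {x y} s (i : Fin (k x y)) → suc (toℕ i) ≡ k x y →
             SubEdge (new x y s i) (old y)

  Sub : OrdStr
  Sub = record { Car = SubVert ; _≤_ = Star SubEdge }

-- S_N(A): exactly one new vertex on each edge of N_diag(A), none elsewhere.
module _ (A : OrdStr) where
  open OrdStr A

  data SNVert : Set where
    old : Car → SNVert
    mid : (x y : Car) → Irrelevant (Covers A x y × NDiag A x y) → SNVert

  data SNEdge : SNVert → SNVert → Set where
    keep : ∀ {x y} → Covers A x y → ¬ NDiag A x y → SNEdge (old x) (old y)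
    up   : ∀ {x y} s → SNEdge (old x) (mid x y s)
    down : ∀ {x y} s → SNEdge (mid x y s) (old y)

  SN : OrdStr
  SN = record { Car = SNVert ; _≤_ = Star SNEdge }

FinPoset : (n : ℕ) → (Fin n → Fin n → Set) → OrdStr
FinPoset n r = record { Car = Fin n ; _≤_ = r }

-- An N of a subdivision Sub P k of Diag(P) can only have an old, unsubdivided edge b ≺ c of P as
-- its diagonal.  Its two other corners are the neighbours of c on some edge a ≺ c and of b on some
-- edge b ≺ d, and these are incomparable exactly when a ≰ d or one of the two edges is subdivided.
-- So S_N(Sub P k) is again a subdivision of Diag(P) with at most one vertex per edge when k is;
-- starting from P ≅ Sub P 0 this identifies S_N(P) and S_N(S_N(P)) with subdivisions Sub P k₁ and
-- Sub P k₂.  The same description of N's shows that an N-free subdivision must subdivide every edge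
-- subdivided by k₁, and then every edge subdivided by k₂.  Finally Sub P k₂ is N-free because the
-- edges it subdivides are closed under N-configurations with a ≤ d.  The key point is that if
-- neither a ≺ c nor b ≺ c is an N-diagonal of P, then a and b have the same upper covers (dually
-- for b ≺ d, b ≺ c and lower covers), which transports an N witnessing the subdivision of a ≺ c
-- or b ≺ d to one for b ≺ c.

module Submission where

open import Defs
open import Level using (0ℓ)
open import Data.Bool.Base using (if_then_else_)
open import Data.Nat using (ℕ; zero; suc; _+_; _∸_; _<_; z≤n; s≤s)
import Data.Nat as ℕ
open import Data.Nat.Properties
  using (_<?_; ≮⇒≥; n≤0⇒n≡0; m<n⇒n≢0; m∸n+n≡m; m<n+m; +-suc; suc-injective; 1+n≢n; <-irrefl)
  renaming (_≟_ to _≟ℕ_)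
open import Data.Fin using (Fin; toℕ; fromℕ; fromℕ<) renaming (zero to fzero; suc to fsuc)
open import Data.Fin.Properties
  using (any?; toℕ<n; toℕ-fromℕ; toℕ-fromℕ<; toℕ-injective) renaming (_≟_ to _≟ᶠ_)
open import Data.Fin.Induction using (po-wellFounded; po-noetherian)
open import Data.Product using (Σ; _×_; _,_; proj₁; proj₂)
open import Data.Sum using (_⊎_; inj₁; inj₂; [_,_]′)
import Data.Sum as Sum
open import Data.Empty using (⊥; ⊥-elim)
open import Data.Empty.Irrelevant using () renaming (⊥-elim to irrelevant-⊥-elim)
open import Data.Irrelevant using (Irrelevant; [_])
import Data.Irrelevant as Irr
open import Function.Base using (_∘_)
open import Function.Bundles using (_↔_; _⇔_; Inverse; Equivalence; mk↔ₛ′; mk⇔)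
open import Function.Properties.Inverse using (↔-sym; ↔-trans)
import Function.Properties.Equivalence as ⇔
open import Induction.WellFounded using (Acc; acc)
open import Relation.Nullary using (¬_; Dec; yes; no; does)
open import Relation.Nullary.Decidable using (_×-dec_; _⊎-dec_; ¬?; recompute)
open import Relation.Binary.Core using (Rel)
open import Relation.Binary.Definitions using (DecidableEquality)
open import Relation.Binary.Structures using (IsDecPartialOrder)
open import Relation.Binary.PropositionalEquality
  using (_≡_; _≢_; refl; sym; trans; cong; subst; subst₂)
open import Relation.Binary.Construct.Closure.ReflexiveTransitive
  using (Star; ε; _◅_; _◅◅_; kleisliStar)

open OrdStr using (Car)

-- Order isomorphisms

record _≅_ (A B : OrdStr) : Set where
  field
    bijection : Car A ↔ Car B
  open Inverse bijection public using (to; from; strictlyInverseˡ; strictlyInverseʳ)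
  field
    order : ∀ u v → OrdStr._≤_ A u v ⇔ OrdStr._≤_ B (to u) (to v)

  monotone : ∀ {u v} → OrdStr._≤_ A u v → OrdStr._≤_ B (to u) (to v)
  monotone = Equivalence.to (order _ _)

  reflects : ∀ {u v} → OrdStr._≤_ B (to u) (to v) → OrdStr._≤_ A u v
  reflects = Equivalence.from (order _ _)

  injective : ∀ {u v} → to u ≡ to v → u ≡ v
  injective {u} {v} e = trans (sym (strictlyInverseʳ u)) (trans (cong from e) (strictlyInverseʳ v))

≅-sym : ∀ {A B} → A ≅ B → B ≅ A
≅-sym {A} {B} φ = record { bijection = ↔-sym (_≅_.bijection φ) ; order = order′ }
  where
  open _≅_ φ
  order′ : ∀ u v → OrdStr._≤_ B u v ⇔ OrdStr._≤_ A (from u) (from v)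
  order′ u v = ⇔.trans
    (subst₂ (λ u′ v′ → OrdStr._≤_ B u v ⇔ OrdStr._≤_ B u′ v′)
            (sym (strictlyInverseˡ u)) (sym (strictlyInverseˡ v)) ⇔.refl)
    (⇔.sym (order (from u) (from v)))

≅-trans : ∀ {A B C} → A ≅ B → B ≅ C → A ≅ C
≅-trans φ ψ = record
  { bijection = ↔-trans (_≅_.bijection φ) (_≅_.bijection ψ)
  ; order     = λ u v → ⇔.trans (_≅_.order φ u v) (_≅_.order ψ _ _)
  }

module _ {A B : OrdStr} (φ : A ≅ B) where
  open _≅_ φ

  Lt-map : ∀ {x y} → Lt A x y → Lt B (to x) (to y)
  Lt-map (x≤y , x≢y) = monotone x≤y , x≢y ∘ injective

  Lt-reflect : ∀ {x y} → Lt B (to x) (to y) → Lt A x y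
  Lt-reflect (x≤y , x≢y) = reflects x≤y , x≢y ∘ cong to

  Covers-map : ∀ {x y} → Covers A x y → Covers B (to x) (to y)
  Covers-map {x} {y} (x<y , nothing-between) = Lt-map x<y , λ (z , x<z , z<y) →
    let z≡to-from-z = sym (strictlyInverseˡ z) in
    nothing-between (from z , Lt-reflect (subst (Lt B (to x)) z≡to-from-z x<z)
                            , Lt-reflect (subst (λ w → Lt B w (to y)) z≡to-from-z z<y))

  Inc-map : ∀ {x y} → Inc A x y → Inc B (to x) (to y)
  Inc-map (x≰y , y≰x) = x≰y ∘ reflects , y≰x ∘ reflects

  IsN-map : ∀ {a b c d} → IsN A a b c d → IsN B (to a) (to b) (to c) (to d)
  IsN-map (bc , ac , bd , ad) = Covers-map bc , Covers-map ac , Covers-map bd , Inc-map ad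

  NDiag-map : ∀ {b c} → NDiag A b c → NDiag B (to b) (to c)
  NDiag-map (a , d , n) = to a , to d , IsN-map n

  NFree-reflect : NFree B → NFree A
  NFree-reflect nf a b c d = nf (to a) (to b) (to c) (to d) ∘ IsN-map

NDiag-reflect : ∀ {A B} (φ : A ≅ B) {b c} → NDiag B (_≅_.to φ b) (_≅_.to φ c) → NDiag A b c
NDiag-reflect {A} φ {b} {c} n =
  subst₂ (NDiag A) (strictlyInverseʳ b) (strictlyInverseʳ c) (NDiag-map (≅-sym φ) n)
  where open _≅_ φ

-- Orders generated by a diagram

StarOrder : {V : Set} → (V → V → Set) → OrdStr
StarOrder {V} E = record { Car = V ; _≤_ = Star E }

module _ {V : Set} {E : V → V → Set} where

  covers⇒edge : DecidableEquality V → (∀ {u v} → E u v → u ≢ v) →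
                ∀ {u v} → Covers (StarOrder E) u v → E u v
  covers⇒edge _≟_ irrefl ((ε , u≢u) , _) with () ← u≢u refl
  covers⇒edge _≟_ irrefl {v = v} ((_◅_ {j = w} e w≤v , _) , nothing-between) with w ≟ v
  ... | yes refl = e
  ... | no w≢v = ⊥-elim (nothing-between (w , (e ◅ ε , irrefl e) , (w≤v , w≢v)))

Star-≅ : ∀ {V W} {E : V → V → Set} {F : W → W → Set} (f : V ↔ W) →
         (∀ {u v} → E u v → Star F (Inverse.to f u) (Inverse.to f v)) →
         (∀ {u v} → F u v → Star E (Inverse.from f u) (Inverse.from f v)) →
         StarOrder E ≅ StarOrder F
Star-≅ {E = E} f to-edge from-edge = record
  { bijection = f
  ; order     = λ u v → mk⇔ (kleisliStar to to-edge)
      (λ p → subst₂ (Star E) (strictlyInverseʳ u) (strictlyInverseʳ v) (kleisliStar from from-edge p))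
  }
  where open Inverse f

mid-cong : ∀ {A : OrdStr} {x x′ y y′ : Car A} {t t′} → x ≡ x′ → y ≡ y′ → mid {A = A} x y t ≡ mid x′ y′ t′
mid-cong refl refl = refl

module _ {A B : OrdStr} (φ : A ≅ B) where
  open _≅_ φ

  SN-map : SNVert A → SNVert B
  SN-map (old x)     = old (to x)
  SN-map (mid x y t) = mid (to x) (to y) (Irr.map (λ (x≺y , nd) → Covers-map φ x≺y , NDiag-map φ nd) t)

  SN-map-edge : ∀ {u v} → SNEdge A u v → SNEdge B (SN-map u) (SN-map v)
  SN-map-edge (keep x≺y ¬nd) = keep (Covers-map φ x≺y) (¬nd ∘ NDiag-reflect φ)
  SN-map-edge (up _)         = up _
  SN-map-edge (down _)       = down _

SN-map-inverse : ∀ {A B} (ψ : A ≅ B) (χ : B ≅ A) → (∀ x → _≅_.to χ (_≅_.to ψ x) ≡ x) →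
                 ∀ u → SN-map χ (SN-map ψ u) ≡ u
SN-map-inverse ψ χ χψ≡id (old x)     = cong old (χψ≡id x)
SN-map-inverse ψ χ χψ≡id (mid x y _) = mid-cong (χψ≡id x) (χψ≡id y)

SN-cong : ∀ {A B} → A ≅ B → SN A ≅ SN B
SN-cong {A} {B} φ = Star-≅
  (mk↔ₛ′ (SN-map φ) (SN-map φ⁻¹) (SN-map-inverse φ⁻¹ φ (_≅_.strictlyInverseˡ φ))
                                 (SN-map-inverse φ φ⁻¹ (_≅_.strictlyInverseʳ φ)))
  ((_◅ ε) ∘ SN-map-edge φ) ((_◅ ε) ∘ SN-map-edge φ⁻¹)
  where
  φ⁻¹ : B ≅ A
  φ⁻¹ = ≅-sym φ

NFree⇒¬NDiag : ∀ {A b c} → NFree A → ¬ NDiag A b c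
NFree⇒¬NDiag nf (a , d , N) = nf a _ _ d N

≮0⇒≡0 : ∀ {m} → ¬ 0 < m → m ≡ 0
≮0⇒≡0 = n≤0⇒n≡0 ∘ ≮⇒≥

Fin⇒0< : ∀ {m} → Fin m → 0 < m
Fin⇒0< {suc _} _ = s≤s z≤n

firstIndex : ∀ m → 0 < m → Σ (Fin m) λ i → toℕ i ≡ 0
firstIndex (suc m) _ = fzero , refl

lastIndex : ∀ m → 0 < m → Σ (Fin m) λ i → suc (toℕ i) ≡ m
lastIndex (suc m) _ = fromℕ m , cong suc (toℕ-fromℕ m)

indicator : ∀ {A : Set} → Dec A → ℕ
indicator a? = if does a? then 1 else 0

indicator≤1 : ∀ {A : Set} (a? : Dec A) → indicator a? ℕ.≤ 1
indicator≤1 (yes _) = s≤s z≤n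
indicator≤1 (no _)  = z≤n

indicator-index : ∀ {A : Set} (a? : Dec A) → .A → Fin (indicator a?)
indicator-index (yes _) _ = fzero
indicator-index (no ¬a) a = irrelevant-⊥-elim (¬a a)

indicator>0⇒ : ∀ {A : Set} (a? : Dec A) → 0 < indicator a? → A
indicator>0⇒ (yes a) _ = a

⇒indicator>0 : ∀ {A : Set} (a? : Dec A) → A → 0 < indicator a?
⇒indicator>0 (yes _) _ = s≤s z≤n
⇒indicator>0 (no ¬a) a = ⊥-elim (¬a a)

Fin≤1-toℕ : ∀ {m} → m ℕ.≤ 1 → (i : Fin m) → toℕ i ≡ 0
Fin≤1-toℕ _ fzero = refl
Fin≤1-toℕ {suc (suc _)} (s≤s ()) (fsuc _)

Fin≤1-last : ∀ {m} → m ℕ.≤ 1 → (i : Fin m) → suc (toℕ i) ≡ m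
Fin≤1-last (s≤s z≤n) fzero = refl

Fin≤1-unique : ∀ {m} → m ℕ.≤ 1 → (i j : Fin m) → i ≡ j
Fin≤1-unique m≤1 i j = toℕ-injective (trans (Fin≤1-toℕ m≤1 i) (sym (Fin≤1-toℕ m≤1 j)))

module FinitePoset (n : ℕ) (_≤_ : Rel (Fin n) 0ℓ) (po : IsDecPartialOrder _≡_ _≤_) where
  open IsDecPartialOrder po public
    using (_≤?_; _≟_; antisym; isPartialOrder) renaming (refl to ≤-refl; trans to ≤-trans)

  P : OrdStr
  P = FinPoset n _≤_

  infix 4 _⊏_ _≺_

  _⊏_ : Fin n → Fin n → Set
  _⊏_ = Lt P

  _≺_ : Fin n → Fin n → Set
  _≺_ = Covers P

  _⊏?_ : ∀ x y → Dec (x ⊏ y)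
  x ⊏? y = (x ≤? y) ×-dec ¬? (x ≟ y)

  between? : ∀ x y → Dec (Σ (Fin n) λ z → x ⊏ z × z ⊏ y)
  between? x y = any? λ z → (x ⊏? z) ×-dec (z ⊏? y)

  _≺?_ : ∀ x y → Dec (x ≺ y)
  x ≺? y = (x ⊏? y) ×-dec ¬? (between? x y)

  ≺⇒≤ : ∀ {x y} → x ≺ y → x ≤ y
  ≺⇒≤ = proj₁ ∘ proj₁

  ≺⇒≢ : ∀ {x y} → x ≺ y → x ≢ y
  ≺⇒≢ = proj₂ ∘ proj₁

  Inc? : ∀ x y → Dec (Inc P x y)
  Inc? x y = ¬? (x ≤? y) ×-dec ¬? (y ≤? x)

  NDiag? : ∀ b c → Dec (NDiag P b c)
  NDiag? b c = any? λ a → any? λ d → (b ≺? c) ×-dec (a ≺? c) ×-dec (b ≺? d) ×-dec Inc? a d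

  private
    lower-cover-from : ∀ x → Acc (λ u v → v ⊏ u) x → ∀ y → x ⊏ y → Σ (Fin n) λ h → x ≤ h × h ≺ y
    lower-cover-from x (acc rec) y x⊏y with x ≺? y
    ... | yes x≺y = x , ≤-refl , x≺y
    ... | no x⊀y with between? x y
    ...   | no nothing-between = ⊥-elim (x⊀y (x⊏y , nothing-between))
    ...   | yes (z , x⊏z , z⊏y) with lower-cover-from z (rec x⊏z) y z⊏y
    ...     | h , z≤h , h≺y = h , ≤-trans (proj₁ x⊏z) z≤h , h≺y

    upper-cover-from : ∀ x y → Acc _⊏_ y → x ⊏ y → Σ (Fin n) λ h → x ≺ h × h ≤ y
    upper-cover-from x y (acc rec) x⊏y with x ≺? y
    ... | yes x≺y = y , x≺y , ≤-refl
    ... | no x⊀y with between? x y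
    ...   | no nothing-between = ⊥-elim (x⊀y (x⊏y , nothing-between))
    ...   | yes (z , x⊏z , z⊏y) with upper-cover-from x z (rec z⊏y) x⊏z
    ...     | h , x≺h , h≤z = h , x≺h , ≤-trans h≤z (proj₁ z⊏y)

  lower-cover : ∀ {x y} → x ⊏ y → Σ (Fin n) λ h → x ≤ h × h ≺ y
  lower-cover {x} {y} = lower-cover-from x (po-noetherian isPartialOrder x) y

  upper-cover : ∀ {x y} → x ⊏ y → Σ (Fin n) λ h → x ≺ h × h ≤ y
  upper-cover {x} {y} = upper-cover-from x y (po-wellFounded isPartialOrder y)

  ≤⇒≺* : ∀ {x y} → x ≤ y → Star _≺_ x y
  ≤⇒≺* {x} {y} = go y (po-wellFounded isPartialOrder y) x
    where
    go : ∀ y → Acc _⊏_ y → ∀ x → x ≤ y → Star _≺_ x y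
    go y (acc rec) x x≤y with x ≟ y
    ... | yes refl = ε
    ... | no x≢y with lower-cover (x≤y , x≢y)
    ...   | h , x≤h , h≺y = go h (rec (≺⇒≤ h≺y , ≺⇒≢ h≺y)) x x≤h ◅◅ (h≺y ◅ ε)

  ≺-between : ∀ {x y w} → x ≺ y → x ≤ w → w ≤ y → w ≡ x ⊎ w ≡ y
  ≺-between {x} {y} {w} x≺y x≤w w≤y with w ≟ x | w ≟ y
  ... | yes w≡x | _        = inj₁ w≡x
  ... | no _    | yes w≡y  = inj₂ w≡y
  ... | no w≢x  | no w≢y   = ⊥-elim (proj₂ x≺y (w , (x≤w , w≢x ∘ sym) , (w≤y , w≢y)))

  ≺-sameTop : ∀ {a b c} → b ≺ c → a ≺ c → b ≤ a → b ≡ a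
  ≺-sameTop b≺c a≺c b≤a with ≺-between b≺c b≤a (≺⇒≤ a≺c)
  ... | inj₁ a≡b = sym a≡b
  ... | inj₂ a≡c = ⊥-elim (≺⇒≢ a≺c a≡c)

  ≺-sameBottom : ∀ {b c d} → b ≺ d → b ≺ c → d ≤ c → d ≡ c
  ≺-sameBottom b≺d b≺c d≤c with ≺-between b≺c (≺⇒≤ b≺d) d≤c
  ... | inj₁ d≡b = ⊥-elim (≺⇒≢ b≺d (sym d≡b))
  ... | inj₂ d≡c = d≡c

  NDiag⊎≤ : ∀ {a b c d} → b ≺ c → a ≺ c → b ≺ d → a ≢ b → NDiag P b c ⊎ a ≤ d
  NDiag⊎≤ {a} {d = d} b≺c a≺c b≺d a≢b with a ≤? d | d ≤? a
  ... | yes a≤d | _       = inj₂ a≤d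
  ... | no a≰d  | no d≰a  = inj₁ (a , d , b≺c , a≺c , b≺d , a≰d , d≰a)
  ... | no _    | yes d≤a = ⊥-elim (a≢b (sym (≺-sameTop b≺c a≺c (≤-trans (≺⇒≤ b≺d) d≤a))))

  -- Subdivisions of Diag(P)

  -- The N-diagonals of Sub P k, read in P; the other two corners of the N lie on a ≺ c and b ≺ d.
  SubNDiag : (Fin n → Fin n → ℕ) → Fin n → Fin n → Set
  SubNDiag k b c = b ≺ c × k b c ≡ 0 × Σ (Fin n) λ a → Σ (Fin n) λ d →
    a ≺ c × b ≺ d × a ≢ b × d ≢ c × (¬ a ≤ d ⊎ 0 < k a c ⊎ 0 < k b d)

  SubNDiag? : ∀ k b c → Dec (SubNDiag k b c)
  SubNDiag? k b c = (b ≺? c) ×-dec (k b c ≟ℕ 0) ×-dec any? λ a → any? λ d →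
    (a ≺? c) ×-dec (b ≺? d) ×-dec ¬? (a ≟ b) ×-dec ¬? (d ≟ c) ×-dec
    (¬? (a ≤? d) ⊎-dec (0 <? k a c) ⊎-dec (0 <? k b d))

  recover≺ : ∀ {x y} → Irrelevant (x ≺ y) → x ≺ y
  recover≺ [ x≺y ] = recompute (_ ≺? _) x≺y

  module Subdivision (k : Fin n → Fin n → ℕ) where

    Q : OrdStr
    Q = Sub P k

    V : Set
    V = SubVert P k

    infix 4 _⊑_ _⋖_

    _⋖_ : V → V → Set
    _⋖_ = SubEdge P k

    _⊑_ : V → V → Set
    _⊑_ = Star _⋖_

    lo : V → Fin n
    lo (old x)       = x
    lo (new x _ _ _) = x

    hi : V → Fin n
    hi (old x)       = x
    hi (new _ y _ _) = y

    ⋖-mono : ∀ {u v} → u ⋖ v → lo u ≤ lo v × hi u ≤ hi v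
    ⋖-mono (direct x≺y _) = ≺⇒≤ x≺y , ≺⇒≤ x≺y
    ⋖-mono (first s _ _)  = ≤-refl , ≺⇒≤ (recover≺ s)
    ⋖-mono (step _ _ _ _) = ≤-refl , ≤-refl
    ⋖-mono (last s _ _)   = ≺⇒≤ (recover≺ s) , ≤-refl

    ⊑-mono : ∀ {u v} → u ⊑ v → lo u ≤ lo v × hi u ≤ hi v
    ⊑-mono ε       = ≤-refl , ≤-refl
    ⊑-mono (e ◅ p) with ⋖-mono e | ⊑-mono p
    ... | lo≤ , hi≤ | lo≤′ , hi≤′ = ≤-trans lo≤ lo≤′ , ≤-trans hi≤ hi≤′

    ⊑-lo : ∀ {u v} → u ⊑ v → lo u ≤ lo v
    ⊑-lo = proj₁ ∘ ⊑-mono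

    ⊑-hi : ∀ {u v} → u ⊑ v → hi u ≤ hi v
    ⊑-hi = proj₂ ∘ ⊑-mono

    ⊑-antisym-old : ∀ {y z} → old y ⊑ z → z ⊑ old y → z ≡ old y
    ⊑-antisym-old {z = old w} y⊑w w⊑y = cong old (antisym (⊑-lo w⊑y) (⊑-lo y⊑w))
    ⊑-antisym-old {z = new _ _ s _} y⊑z z⊑y =
      ⊥-elim (≺⇒≢ (recover≺ s) (trans (antisym (⊑-lo z⊑y) (⊑-lo y⊑z)) (antisym (⊑-hi y⊑z) (⊑-hi z⊑y))))

    ⋖-irrefl : ∀ {u v} → u ⋖ v → u ≢ v
    ⋖-irrefl (direct x≺y _)    refl = ≺⇒≢ x≺y refl
    ⋖-irrefl (step _ i .i i+1≡i) refl = 1+n≢n i+1≡i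

    _≟ᵥ_ : DecidableEquality V
    old x ≟ᵥ old y with x ≟ y
    ... | yes refl = yes refl
    ... | no x≢y   = no λ { refl → x≢y refl }
    old _ ≟ᵥ new _ _ _ _ = no λ ()
    new _ _ _ _ ≟ᵥ old _ = no λ ()
    new x y _ i ≟ᵥ new x′ y′ _ i′ with x ≟ x′ | y ≟ y′
    ... | no x≢x′ | _        = no λ { refl → x≢x′ refl }
    ... | yes refl | no y≢y′ = no λ { refl → y≢y′ refl }
    ... | yes refl | yes refl with i ≟ᶠ i′
    ...   | yes refl = yes refl
    ...   | no i≢i′  = no λ { refl → i≢i′ refl }

    covers⇒⋖ : ∀ {u v} → Covers Q u v → u ⋖ v
    covers⇒⋖ = covers⇒edge _≟ᵥ_ ⋖-irrefl

    ⋖-into-new-unique : ∀ {u u′ x y s j} → u ⋖ new x y s j → u′ ⋖ new x y s j → u ≡ u′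
    ⋖-into-new-unique (first _ _ _) (first _ _ _) = refl
    ⋖-into-new-unique (first _ _ j≡0) (step _ _ _ i+1≡j) with () ← trans i+1≡j j≡0
    ⋖-into-new-unique (step _ _ _ i+1≡j) (first _ _ j≡0) with () ← trans i+1≡j j≡0
    ⋖-into-new-unique (step _ i _ i+1≡j) (step _ i′ _ i′+1≡j) =
      cong (new _ _ _) (toℕ-injective (suc-injective (trans i+1≡j (sym i′+1≡j))))

    ⋖-from-new-unique : ∀ {v v′ x y s i} → new x y s i ⋖ v → new x y s i ⋖ v′ → v ≡ v′
    ⋖-from-new-unique (step _ _ j i+1≡j) (step _ _ j′ i+1≡j′) =
      cong (new _ _ _) (toℕ-injective (trans (sym i+1≡j) i+1≡j′))
    ⋖-from-new-unique (step _ _ j i+1≡j) (last _ _ i+1≡k) =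
      ⊥-elim (<-irrefl (trans (sym i+1≡j) i+1≡k) (toℕ<n j))
    ⋖-from-new-unique (last _ _ i+1≡k) (step _ _ j i+1≡j) =
      ⊥-elim (<-irrefl (trans (sym i+1≡j) i+1≡k) (toℕ<n j))
    ⋖-from-new-unique (last _ _ _) (last _ _ _) = refl

    direct-covers : ∀ {x y} → x ≺ y → k x y ≡ 0 → Covers Q (old x) (old y)
    direct-covers {x} {y} x≺y k≡0 = (direct x≺y k≡0 ◅ ε , λ { refl → ≺⇒≢ x≺y refl }) , nothing-between
      where
      nothing-between : ¬ Σ V λ z → Lt Q (old x) z × Lt Q z (old y)
      nothing-between (old w , (x⊑w , x≢w) , (w⊑y , w≢y)) with ≺-between x≺y (⊑-lo x⊑w) (⊑-lo w⊑y)
      ... | inj₁ refl = x≢w refl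
      ... | inj₂ refl = w≢y refl
      nothing-between (new _ _ s i , (x⊑z , _) , (z⊑y , _)) with ≺-between x≺y (⊑-lo x⊑z) (⊑-lo z⊑y)
      ... | inj₂ refl = ≺⇒≢ (recover≺ s) (antisym (≺⇒≤ (recover≺ s)) (⊑-hi z⊑y))
      ... | inj₁ refl with ≺-between x≺y (⊑-hi x⊑z) (⊑-hi z⊑y)
      ...   | inj₁ refl = ≺⇒≢ (recover≺ s) refl
      ...   | inj₂ refl with () ← subst Fin k≡0 i

    ⊑-into-first : ∀ {x y s i z} → toℕ i ≡ 0 → z ⊑ new x y s i → z ≡ new x y s i ⊎ z ⊑ old x
    ⊑-into-first i≡0 ε = inj₁ refl
    ⊑-into-first i≡0 (e ◅ p) with ⊑-into-first i≡0 p
    ... | inj₂ w⊑x = inj₂ (e ◅ w⊑x)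
    ... | inj₁ refl = inj₂ (subst (_⊑ _) (⋖-into-new-unique (first _ _ i≡0) e) ε)

    first-covers : ∀ {x y s i} → toℕ i ≡ 0 → Covers Q (old x) (new x y s i)
    first-covers i≡0 = (first _ _ i≡0 ◅ ε , λ ()) , λ (z , (x⊑z , x≢z) , (z⊑i , z≢i)) →
      [ z≢i , (λ z⊑x → x≢z (sym (⊑-antisym-old x⊑z z⊑x))) ]′ (⊑-into-first i≡0 z⊑i)

    last-covers : ∀ {x y s i} → suc (toℕ i) ≡ k x y → Covers Q (new x y s i) (old y)
    last-covers i+1≡k = (last _ _ i+1≡k ◅ ε , λ ()) , λ where
      (z , (ε , i≢i) , _) → i≢i refl
      (z , (e ◅ y⊑z , _) , (z⊑y , z≢y)) →
        z≢y (⊑-antisym-old (subst (_⊑ z) (⋖-from-new-unique e (last _ _ i+1≡k)) y⊑z) z⊑y)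

    new⊑top : ∀ {x y} s (i : Fin (k x y)) → new x y s i ⊑ old y
    new⊑top {x} {y} s i = climb (k x y ∸ suc (toℕ i)) i (m∸n+n≡m (toℕ<n i))
      where
      climb : ∀ m (i : Fin (k x y)) → m + suc (toℕ i) ≡ k x y → new x y s i ⊑ old y
      climb zero    i i+1≡k = last s i i+1≡k ◅ ε
      climb (suc m) i m+i+2≡k = step s i j (sym (toℕ-fromℕ< i+1<k)) ◅ climb m j m+j+1≡k
        where
        i+1<k : suc (toℕ i) < k x y
        i+1<k = subst (suc (toℕ i) <_) m+i+2≡k (m<n+m (suc (toℕ i)) (s≤s z≤n))
        j : Fin (k x y)
        j = fromℕ< i+1<k
        m+j+1≡k : m + suc (toℕ j) ≡ k x y
        m+j+1≡k = trans (cong (λ t → m + suc t) (toℕ-fromℕ< i+1<k))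
                        (trans (+-suc m (suc (toℕ i))) m+i+2≡k)

    ≺⇒⊑ : ∀ {x y} → x ≺ y → old x ⊑ old y
    ≺⇒⊑ {x} {y} x≺y with 0 <? k x y
    ... | no k≯0 = direct x≺y (≮0⇒≡0 k≯0) ◅ ε
    ... | yes k>0 with firstIndex (k x y) k>0
    ...   | i , i≡0 = first [ x≺y ] i i≡0 ◅ new⊑top [ x≺y ] i

    ≤⇒⊑ : ∀ {x y} → x ≤ y → old x ⊑ old y
    ≤⇒⊑ = kleisliStar old ≺⇒⊑ ∘ ≤⇒≺*

    ¬NDiag-new-top : ∀ {u x y s i} → ¬ NDiag Q u (new x y s i)
    ¬NDiag-new-top (a , d , u≺i , a≺i , u≺d , a∥d) =
      proj₁ a∥d (subst (_⊑ d) (⋖-into-new-unique (covers⇒⋖ u≺i) (covers⇒⋖ a≺i)) (proj₁ (proj₁ u≺d)))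

    ¬NDiag-new-bottom : ∀ {v x y s i} → ¬ NDiag Q (new x y s i) v
    ¬NDiag-new-bottom (a , d , i≺v , a≺v , i≺d , a∥d) =
      proj₁ a∥d (subst (a ⊑_) (⋖-from-new-unique (covers⇒⋖ i≺v) (covers⇒⋖ i≺d)) (proj₁ (proj₁ a≺v)))

    NDiag⇒SubNDiag : ∀ {b c} → NDiag Q (old b) (old c) → SubNDiag k b c
    NDiag⇒SubNDiag {b} {c} (_ , _ , b≺c , a≺c , b≺d , a∥d) with covers⇒⋖ b≺c
    ... | direct b≺c k≡0 = b≺c , k≡0 , corners (covers⇒⋖ a≺c) (covers⇒⋖ b≺d) (proj₁ a∥d)
      where
      empty : Fin (k b c) → ⊥
      empty i with () ← subst Fin k≡0 i
      corners : ∀ {a′ d′} → a′ ⋖ old c → old b ⋖ d′ → ¬ a′ ⊑ d′ → Σ (Fin n) λ a → Σ (Fin n) λ d →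
                a ≺ c × b ≺ d × a ≢ b × d ≢ c × (¬ a ≤ d ⊎ 0 < k a c ⊎ 0 < k b d)
      corners a⋖c@(direct a≺c _) b⋖d@(direct b≺d _) a⋢d =
        _ , _ , a≺c , b≺d , (λ { refl → a⋢d (b⋖d ◅ ε) }) , (λ { refl → a⋢d (a⋖c ◅ ε) }) ,
        inj₁ (a⋢d ∘ ≤⇒⊑)
      corners a⋖c@(last s i _) (direct b≺d _) a⋢d =
        _ , _ , recover≺ s , b≺d , (λ { refl → empty i }) , (λ { refl → a⋢d (a⋖c ◅ ε) }) ,
        inj₂ (inj₁ (Fin⇒0< i))
      corners (direct a≺c _) b⋖d@(first s j _) a⋢d =
        _ , _ , a≺c , recover≺ s , (λ { refl → a⋢d (b⋖d ◅ ε) }) , (λ { refl → empty j }) ,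
        inj₂ (inj₂ (Fin⇒0< j))
      corners (last s i _) (first s′ j _) _ =
        _ , _ , recover≺ s , recover≺ s′ , (λ { refl → empty i }) , (λ { refl → empty j }) ,
        inj₂ (inj₁ (Fin⇒0< i))

    bottomNew : ∀ {x y} → x ≺ y → 0 < k x y → V
    bottomNew {x} {y} x≺y k>0 = new x y [ x≺y ] (proj₁ (firstIndex (k x y) k>0))

    topNew : ∀ {x y} → x ≺ y → 0 < k x y → V
    topNew {x} {y} x≺y k>0 = new x y [ x≺y ] (proj₁ (lastIndex (k x y) k>0))

    bottomNew-covers : ∀ {x y} (x≺y : x ≺ y) (k>0 : 0 < k x y) → Covers Q (old x) (bottomNew x≺y k>0)
    bottomNew-covers {x} {y} _ k>0 = first-covers (proj₂ (firstIndex (k x y) k>0))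

    topNew-covers : ∀ {x y} (x≺y : x ≺ y) (k>0 : 0 < k x y) → Covers Q (topNew x≺y k>0) (old y)
    topNew-covers {x} {y} _ k>0 = last-covers (proj₂ (lastIndex (k x y) k>0))

    NDiag-from-corners : ∀ {a b c a′ d′} → b ≺ c → k b c ≡ 0 → a ≺ c → a ≢ b →
                         Covers Q a′ (old c) → Covers Q (old b) d′ → lo a′ ≡ a → b ≤ lo d′ →
                         ¬ a′ ⊑ d′ → NDiag Q (old b) (old c)
    NDiag-from-corners {a′ = a′} {d′} b≺c k≡0 a≺c a≢b a′≺c b≺d′ refl b≤d′ a′⋢d′ =
      a′ , d′ , direct-covers b≺c k≡0 , a′≺c , b≺d′ , a′⋢d′ ,
      λ d′⊑a′ → a≢b (sym (≺-sameTop b≺c a≺c (≤-trans b≤d′ (⊑-lo d′⊑a′))))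

    SubNDiag⇒NDiag : ∀ {b c} → SubNDiag k b c → NDiag Q (old b) (old c)
    SubNDiag⇒NDiag {b} {c} (b≺c , k≡0 , a , d , a≺c , b≺d , a≢b , d≢c , a≰d⊎subdivided)
      with 0 <? k a c | 0 <? k b d
    ... | yes kac>0 | yes kbd>0 =
      NDiag-from-corners b≺c k≡0 a≺c a≢b (topNew-covers a≺c kac>0) (bottomNew-covers b≺d kbd>0)
        refl ≤-refl (λ c⊑d → d≢c (sym (≺-sameBottom b≺c b≺d (⊑-hi c⊑d))))
    ... | yes kac>0 | no kbd≯0 =
      NDiag-from-corners b≺c k≡0 a≺c a≢b (topNew-covers a≺c kac>0) (direct-covers b≺d (≮0⇒≡0 kbd≯0))
        refl (≺⇒≤ b≺d) (λ c⊑d → d≢c (sym (≺-sameBottom b≺c b≺d (⊑-hi c⊑d))))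
    ... | no kac≯0 | yes kbd>0 =
      NDiag-from-corners b≺c k≡0 a≺c a≢b (direct-covers a≺c (≮0⇒≡0 kac≯0)) (bottomNew-covers b≺d kbd>0)
        refl ≤-refl (λ a⊑b → a≢b (≺-sameTop a≺c b≺c (⊑-lo a⊑b)))
    ... | no kac≯0 | no kbd≯0 =
      NDiag-from-corners b≺c k≡0 a≺c a≢b
        (direct-covers a≺c (≮0⇒≡0 kac≯0)) (direct-covers b≺d (≮0⇒≡0 kbd≯0))
        refl (≺⇒≤ b≺d) (λ a⊑d → [ (λ a≰d → a≰d (⊑-lo a⊑d)) , [ kac≯0 , kbd≯0 ]′ ]′ a≰d⊎subdivided)

    NFree-Sub : (∀ b c → ¬ SubNDiag k b c) → NFree Q
    NFree-Sub none a (old b) (old c) d N = none b c (NDiag⇒SubNDiag (a , d , N))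
    NFree-Sub none a (old b) (new _ _ _ _) d N = ¬NDiag-new-top (a , d , N)
    NFree-Sub none a (new _ _ _ _) c d N = ¬NDiag-new-bottom (a , d , N)

  P≅Sub₀ : P ≅ Sub P (λ _ _ → 0)
  P≅Sub₀ = record
    { bijection = mk↔ₛ′ old from-old (λ { (old _) → refl ; (new _ _ _ ()) }) (λ _ → refl)
    ; order     = λ _ _ → mk⇔ ≤⇒⊑ ⊑-lo
    }
    where
    open Subdivision (λ _ _ → 0)
    from-old : V → Fin n
    from-old (old x)        = x
    from-old (new _ _ _ ())

  growth? : ∀ k x y → Dec (0 < k x y ⊎ SubNDiag k x y)
  growth? k x y = 0 <? k x y ⊎-dec SubNDiag? k x y

  -- S_N of a subdivision

  -- S_N(Sub P k) ≅ Sub P (grow k) whenever k ≤ 1, see SN-Sub≅.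
  grow : (Fin n → Fin n → ℕ) → Fin n → Fin n → ℕ
  grow k x y = indicator (growth? k x y)

  grow>0⇒ : ∀ {k x y} → 0 < grow k x y → 0 < k x y ⊎ SubNDiag k x y
  grow>0⇒ {k} {x} {y} = indicator>0⇒ (growth? k x y)

  ⇒grow>0 : ∀ {k x y} → 0 < k x y ⊎ SubNDiag k x y → 0 < grow k x y
  ⇒grow>0 {k} {x} {y} = ⇒indicator>0 (growth? k x y)

  module SN-Sub (k : Fin n → Fin n → ℕ) (k≤1 : ∀ x y → k x y ℕ.≤ 1) where
    module S = Subdivision k
    module G = Subdivision (grow k)

    grow-index : ∀ {x y} → .(0 < k x y ⊎ SubNDiag k x y) → Fin (grow k x y)
    grow-index {x} {y} = indicator-index (growth? k x y)

    to : SNVert S.Q → G.V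
    to (old (old x))            = old x
    to (old (new x y s i))      = new x y s (grow-index (inj₁ (Fin⇒0< i)))
    to (mid (old x) (old y) [ t ]) =
      new x y [ proj₁ (S.NDiag⇒SubNDiag (proj₂ t)) ] (grow-index (inj₂ (S.NDiag⇒SubNDiag (proj₂ t))))
    to (mid (old _) (new _ _ _ _) [ t ]) = irrelevant-⊥-elim (S.¬NDiag-new-top (proj₂ t))
    to (mid (new _ _ _ _) _ [ t ])       = irrelevant-⊥-elim (S.¬NDiag-new-bottom (proj₂ t))

    -- Abstracted over the two decisions that define grow k x y, so that proofs can case on them.
    fromNew : ∀ {x y} → Irrelevant (x ≺ y) → (p? : Dec (0 < k x y)) (q? : Dec (SubNDiag k x y)) →
              Fin (indicator (p? ⊎-dec q?)) → SNVert S.Q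
    fromNew s (yes k>0) _ _        = old (S.bottomNew (recover≺ s) k>0)
    fromNew s (no _) (yes subN@(x≺y , k≡0 , _)) _ =
      mid (old _) (old _) [ S.direct-covers x≺y k≡0 , S.SubNDiag⇒NDiag subN ]

    from : G.V → SNVert S.Q
    from (old x)       = old (old x)
    from (new x y s j) = fromNew s (0 <? k x y) (SubNDiag? k x y) j

    to-fromNew : ∀ {x y} s p? q? j →
                 Σ (Fin (grow k x y)) λ j′ → to (fromNew {x} {y} s p? q? j) ≡ new x y s j′
    to-fromNew s (yes _) _ _      = _ , refl
    to-fromNew s (no _) (yes _) _ = _ , refl

    to-from : ∀ v → to (from v) ≡ v
    to-from (old x)       = refl
    to-from (new x y s j) with to-fromNew s (0 <? k x y) (SubNDiag? k x y) j
    ... | j′ , e = trans e (cong (new x y s) (Fin≤1-unique (indicator≤1 (growth? k x y)) j′ j))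

    fromNew-old : ∀ {x y} s p? q? j (i : Fin (k x y)) → fromNew s p? q? j ≡ old (new x y s i)
    fromNew-old {x} {y} s (yes k>0) _ _ i =
      cong (λ i′ → old (new x y s i′)) (Fin≤1-unique (k≤1 x y) _ i)
    fromNew-old s (no k≯0) _ _ i = ⊥-elim (k≯0 (Fin⇒0< i))

    fromNew-mid : ∀ {x y} s p? q? j {t} → .(k x y ≡ 0) →
                  fromNew {x} {y} s p? q? j ≡ mid (old x) (old y) t
    fromNew-mid s (yes k>0) _ _ k≡0 = irrelevant-⊥-elim (m<n⇒n≢0 k>0 k≡0)
    fromNew-mid s (no _) (yes _) _ _ = refl

    from-to : ∀ u → from (to u) ≡ u
    from-to (old (old x))       = refl
    from-to (old (new x y s i)) = fromNew-old _ (0 <? k x y) (SubNDiag? k x y) _ i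
    from-to (mid (old x) (old y) [ t ]) =
      fromNew-mid _ (0 <? k x y) (SubNDiag? k x y) _ (proj₁ (proj₂ (S.NDiag⇒SubNDiag (proj₂ t))))
    from-to (mid (old _) (new _ _ _ _) [ t ]) = irrelevant-⊥-elim (S.¬NDiag-new-top (proj₂ t))
    from-to (mid (new _ _ _ _) _ [ t ])       = irrelevant-⊥-elim (S.¬NDiag-new-bottom (proj₂ t))

    grow-index-first : ∀ {x y} (j : Fin (grow k x y)) → toℕ j ≡ 0
    grow-index-first {x} {y} = Fin≤1-toℕ (indicator≤1 (growth? k x y))

    grow-index-last : ∀ {x y} (j : Fin (grow k x y)) → suc (toℕ j) ≡ grow k x y
    grow-index-last {x} {y} = Fin≤1-last (indicator≤1 (growth? k x y))

    no-step-S : ∀ {x y s i j} → ¬ (new x y s i S.⋖ new x y s j)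
    no-step-S {x} {y} (step _ _ j i+1≡j) with () ← trans i+1≡j (Fin≤1-toℕ (k≤1 x y) j)

    no-step-G : ∀ {x y s i j} → ¬ (new x y s i G.⋖ new x y s j)
    no-step-G (step _ _ j i+1≡j) with () ← trans i+1≡j (grow-index-first j)

    to-edge : ∀ {u v} → SNEdge S.Q u v → to u G.⋖ to v
    to-edge (keep u≺v ¬nd) with S.covers⇒⋖ u≺v
    ... | direct {x} {y} x≺y k≡0 =
      direct x≺y (≮0⇒≡0 ([ (λ k>0 → m<n⇒n≢0 k>0 k≡0) , ¬nd ∘ S.SubNDiag⇒NDiag ]′ ∘ grow>0⇒))
    ... | first _ _ _ = first _ _ (grow-index-first _)
    ... | e@(step _ _ _ _) = ⊥-elim (no-step-S e)
    ... | last _ _ _  = last _ _ (grow-index-last _)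
    to-edge (up {old _} {old _} _)           = first _ _ (grow-index-first _)
    to-edge (up {old _} {new _ _ _ _} [ t ]) = irrelevant-⊥-elim (S.¬NDiag-new-top (proj₂ t))
    to-edge (up {new _ _ _ _} [ t ])         = irrelevant-⊥-elim (S.¬NDiag-new-bottom (proj₂ t))
    to-edge (down {old _} {old _} _)           = last _ _ (grow-index-last _)
    to-edge (down {old _} {new _ _ _ _} [ t ]) = irrelevant-⊥-elim (S.¬NDiag-new-top (proj₂ t))
    to-edge (down {new _ _ _ _} [ t ])         = irrelevant-⊥-elim (S.¬NDiag-new-bottom (proj₂ t))

    fromNew-first : ∀ {x y} s p? q? j → Star (SNEdge S.Q) (old (old x)) (fromNew {x} {y} s p? q? j)
    fromNew-first s (yes k>0) _ _      = keep (S.bottomNew-covers (recover≺ s) k>0) S.¬NDiag-new-top ◅ ε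
    fromNew-first s (no _) (yes _) _ = up _ ◅ ε

    fromNew-last : ∀ {x y} s p? q? j → Star (SNEdge S.Q) (fromNew {x} {y} s p? q? j) (old (old y))
    fromNew-last {x} {y} s (yes k>0) _ _ =
      keep (S.last-covers (Fin≤1-last (k≤1 x y) _)) S.¬NDiag-new-bottom ◅ ε
    fromNew-last s (no _) (yes _) _ = down _ ◅ ε

    from-edge : ∀ {u v} → u G.⋖ v → Star (SNEdge S.Q) (from u) (from v)
    from-edge (direct {x} {y} x≺y g≡0) =
      keep (S.direct-covers x≺y (≮0⇒≡0 (no-growth ∘ inj₁))) (no-growth ∘ inj₂ ∘ S.NDiag⇒SubNDiag) ◅ ε
      where
      no-growth : ¬ (0 < k x y ⊎ SubNDiag k x y)
      no-growth growth = m<n⇒n≢0 (⇒grow>0 growth) g≡0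
    from-edge (first {x} {y} s j _)  = fromNew-first s (0 <? k x y) (SubNDiag? k x y) j
    from-edge e@(step _ _ _ _)       = ⊥-elim (no-step-G e)
    from-edge (last {x} {y} s j _)   = fromNew-last s (0 <? k x y) (SubNDiag? k x y) j

    SN-Sub≅ : SN S.Q ≅ G.Q
    SN-Sub≅ = Star-≅ (mk↔ₛ′ to from to-from from-to) ((_◅ ε) ∘ to-edge) from-edge

  -- N-freeness and minimality of S_N(S_N(P))

  ≺-≺-¬≺ : ∀ {x y z} → x ≺ y → y ≺ z → ¬ x ≺ z
  ≺-≺-¬≺ {y = y} x≺y y≺z x≺z = proj₂ x≺z (y , proj₁ x≺y , proj₁ y≺z)

  upper-cover-transfer : ∀ {a b c z} → a ≺ c → b ≺ c → a ≺ z → a ≢ b →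
                         ¬ NDiag P a c → ¬ NDiag P b c → b ≺ z
  upper-cover-transfer {b = b} {z = z} a≺c b≺c a≺z a≢b ¬ac ¬bc
    with NDiag⊎≤ a≺c b≺c a≺z (a≢b ∘ sym)
  ... | inj₁ ac = ⊥-elim (¬ac ac)
  ... | inj₂ b≤z with b ≟ z
  ...   | yes refl = ⊥-elim (≺-≺-¬≺ a≺z b≺c a≺c)
  ...   | no b≢z with upper-cover (b≤z , b≢z)
  ...     | h , b≺h , h≤z with NDiag⊎≤ b≺c a≺c b≺h a≢b
  ...       | inj₁ bc = ⊥-elim (¬bc bc)
  ...       | inj₂ a≤h with ≺-between a≺z a≤h h≤z
  ...         | inj₁ refl = ⊥-elim (≺-≺-¬≺ b≺h a≺c b≺c)
  ...         | inj₂ refl = b≺h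

  lower-cover-transfer : ∀ {b c d z} → b ≺ d → b ≺ c → z ≺ d →
                         ¬ NDiag P b d → ¬ NDiag P b c → z ≺ c
  lower-cover-transfer {b} {c} {z = z} b≺d b≺c z≺d ¬bd ¬bc with z ≟ b
  ... | yes refl = b≺c
  ... | no z≢b with NDiag⊎≤ b≺d z≺d b≺c z≢b
  ...   | inj₁ bd = ⊥-elim (¬bd bd)
  ...   | inj₂ z≤c with z ≟ c
  ...     | yes refl = ⊥-elim (≺-≺-¬≺ b≺c z≺d b≺d)
  ...     | no z≢c with lower-cover (z≤c , z≢c)
  ...       | h , z≤h , h≺c with h ≟ b
  ...         | yes refl = ⊥-elim (z≢b (≺-sameTop z≺d b≺d z≤h))
  ...         | no h≢b with NDiag⊎≤ b≺c h≺c b≺d h≢b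
  ...           | inj₁ bc = ⊥-elim (¬bc bc)
  ...           | inj₂ h≤d with ≺-between z≺d z≤h h≤d
  ...             | inj₁ refl = h≺c
  ...             | inj₂ refl = ⊥-elim (≺-≺-¬≺ b≺d h≺c b≺c)

  -- Apart from those in NDiag P, these are the N-diagonals of S_N(P).
  NDiag₂ : Fin n → Fin n → Set
  NDiag₂ b c = b ≺ c × Σ (Fin n) λ a → Σ (Fin n) λ d →
    a ≺ c × b ≺ d × a ≢ b × d ≢ c × a ≤ d × (NDiag P a c ⊎ NDiag P b d)

  Refined : Fin n → Fin n → Set
  Refined b c = NDiag P b c ⊎ NDiag₂ b c

  Refined-closedˡ : ∀ {a b c d} → a ≺ c → b ≺ c → b ≺ d → a ≢ b → d ≢ c → a ≤ d →
                    ¬ NDiag P b c → NDiag₂ a c → Refined b c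
  Refined-closedˡ {a} {b} {c} {d} a≺c b≺c b≺d a≢b d≢c a≤d ¬bc
                  (_ , x , y , x≺c , a≺y , _ , y≢c , _ , xc⊎ay)
    with NDiag? a c
  ... | yes ac = inj₂ (b≺c , a , d , a≺c , b≺d , a≢b , d≢c , a≤d , inj₁ ac)
  ... | no ¬ac with xc⊎ay
  ...   | inj₂ (u , v , _ , u≺y , a≺v , u∥v) =
    inj₂ (b≺c , a , y , a≺c , transfer a≺y , a≢b , y≢c , ≺⇒≤ a≺y ,
          inj₂ (u , v , transfer a≺y , u≺y , transfer a≺v , u∥v))
    where
    transfer : ∀ {z} → a ≺ z → b ≺ z
    transfer a≺z = upper-cover-transfer a≺c b≺c a≺z a≢b ¬ac ¬bc
  ...   | inj₁ xc with x ≟ b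
  ...     | yes refl = inj₁ xc
  ...     | no x≢b with NDiag⊎≤ b≺c x≺c b≺d x≢b
  ...       | inj₁ bc = inj₁ bc
  ...       | inj₂ x≤d = inj₂ (b≺c , x , d , x≺c , b≺d , x≢b , d≢c , x≤d , inj₁ xc)

  Refined-closedʳ : ∀ {a b c d} → a ≺ c → b ≺ c → b ≺ d → a ≢ b → d ≢ c → a ≤ d →
                    ¬ NDiag P b c → NDiag₂ b d → Refined b c
  Refined-closedʳ {a} {b} {c} {d} a≺c b≺c b≺d a≢b d≢c a≤d ¬bc
                  (_ , x , y , x≺d , b≺y , x≢b , _ , _ , xd⊎by)
    with NDiag? b d
  ... | yes bd = inj₂ (b≺c , a , d , a≺c , b≺d , a≢b , d≢c , a≤d , inj₂ bd)
  ... | no ¬bd with xd⊎by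
  ...   | inj₁ (u , v , _ , u≺d , x≺v , u∥v) =
    inj₂ (b≺c , x , d , transfer x≺d , b≺d , x≢b , d≢c , ≺⇒≤ x≺d ,
          inj₁ (u , v , transfer x≺d , transfer u≺d , x≺v , u∥v))
    where
    transfer : ∀ {z} → z ≺ d → z ≺ c
    transfer z≺d = lower-cover-transfer b≺d b≺c z≺d ¬bd ¬bc
  ...   | inj₂ by with y ≟ c
  ...     | yes refl = inj₁ by
  ...     | no y≢c with NDiag⊎≤ b≺c a≺c b≺y a≢b
  ...       | inj₁ bc = inj₁ bc
  ...       | inj₂ a≤y = inj₂ (b≺c , a , y , a≺c , b≺y , a≢b , y≢c , a≤y , inj₂ by)

  Refined-closed : ∀ {a b c d} → a ≺ c → b ≺ c → b ≺ d → a ≢ b → d ≢ c → a ≤ d →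
                   Refined a c ⊎ Refined b d → Refined b c
  Refined-closed {b = b} {c} a≺c b≺c b≺d a≢b d≢c a≤d ac⊎bd with NDiag? b c
  ... | yes bc = inj₁ bc
  ... | no ¬bc with ac⊎bd
  ...   | inj₁ (inj₁ ac)  = inj₂ (b≺c , _ , _ , a≺c , b≺d , a≢b , d≢c , a≤d , inj₁ ac)
  ...   | inj₂ (inj₁ bd)  = inj₂ (b≺c , _ , _ , a≺c , b≺d , a≢b , d≢c , a≤d , inj₂ bd)
  ...   | inj₁ (inj₂ ac₂) = Refined-closedˡ a≺c b≺c b≺d a≢b d≢c a≤d ¬bc ac₂
  ...   | inj₂ (inj₂ bd₂) = Refined-closedʳ a≺c b≺c b≺d a≢b d≢c a≤d ¬bc bd₂

  -- k₁ and k₂ count the vertices that S_N(P) and S_N(S_N(P)) add on the edges of P.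
  k₀ k₁ k₂ : Fin n → Fin n → ℕ
  k₀ _ _ = 0
  k₁ = grow k₀
  k₂ = grow k₁

  NDiag⇒SubNDiag₀ : ∀ {b c} → NDiag P b c → SubNDiag k₀ b c
  NDiag⇒SubNDiag₀ (a , d , b≺c , a≺c , b≺d , a≰d , _) =
    b≺c , refl , a , d , a≺c , b≺d ,
    (λ { refl → a≰d (≺⇒≤ b≺d) }) , (λ { refl → a≰d (≺⇒≤ a≺c) }) , inj₁ a≰d

  SubNDiag₀⇒NDiag : ∀ {b c} → SubNDiag k₀ b c → NDiag P b c
  SubNDiag₀⇒NDiag (b≺c , _ , a , d , a≺c , b≺d , a≢b , _ , inj₁ a≰d) =
    a , d , b≺c , a≺c , b≺d , a≰d , λ d≤a → a≢b (sym (≺-sameTop b≺c a≺c (≤-trans (≺⇒≤ b≺d) d≤a)))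
  SubNDiag₀⇒NDiag (_ , _ , _ , _ , _ , _ , _ , _ , inj₂ (inj₁ ()))
  SubNDiag₀⇒NDiag (_ , _ , _ , _ , _ , _ , _ , _ , inj₂ (inj₂ ()))

  k₁>0⇒NDiag : ∀ {x y} → 0 < k₁ x y → NDiag P x y
  k₁>0⇒NDiag k>0 with grow>0⇒ k>0
  ... | inj₁ ()
  ... | inj₂ subN = SubNDiag₀⇒NDiag subN

  NDiag⇒k₁>0 : ∀ {x y} → NDiag P x y → 0 < k₁ x y
  NDiag⇒k₁>0 = ⇒grow>0 ∘ inj₂ ∘ NDiag⇒SubNDiag₀

  k₂>0⇒Refined : ∀ {x y} → 0 < k₂ x y → Refined x y
  k₂>0⇒Refined k>0 with grow>0⇒ k>0
  ... | inj₁ k₁>0 = inj₁ (k₁>0⇒NDiag k₁>0)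
  ... | inj₂ (x≺y , _ , a , d , a≺y , x≺d , a≢x , d≢y , a≰d⊎refined) with NDiag⊎≤ x≺y a≺y x≺d a≢x
  ...   | inj₁ xy = inj₁ xy
  ...   | inj₂ a≤d = inj₂ (x≺y , a , d , a≺y , x≺d , a≢x , d≢y , a≤d ,
                           [ (λ a≰d → ⊥-elim (a≰d a≤d)) , Sum.map k₁>0⇒NDiag k₁>0⇒NDiag ]′ a≰d⊎refined)

  Refined⇒k₂>0 : ∀ {x y} → Refined x y → 0 < k₂ x y
  Refined⇒k₂>0 (inj₁ xy) = ⇒grow>0 (inj₁ (NDiag⇒k₁>0 xy))
  Refined⇒k₂>0 {x} {y} (inj₂ (x≺y , a , d , a≺y , x≺d , a≢x , d≢y , _ , ay⊎xd)) with NDiag? x y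
  ... | yes xy = ⇒grow>0 (inj₁ (NDiag⇒k₁>0 xy))
  ... | no ¬xy = ⇒grow>0 (inj₂ (x≺y , ≮0⇒≡0 (¬xy ∘ k₁>0⇒NDiag) , a , d , a≺y , x≺d , a≢x , d≢y ,
                                inj₂ (Sum.map NDiag⇒k₁>0 NDiag⇒k₁>0 ay⊎xd)))

  ¬SubNDiag-k₂ : ∀ {b c} → ¬ SubNDiag k₂ b c
  ¬SubNDiag-k₂ {b} {c} (b≺c , k≡0 , a , d , a≺c , b≺d , a≢b , d≢c , a≰d⊎refined)
    with NDiag⊎≤ b≺c a≺c b≺d a≢b
  ... | inj₁ bc = m<n⇒n≢0 (Refined⇒k₂>0 (inj₁ bc)) k≡0
  ... | inj₂ a≤d with a≰d⊎refined
  ...   | inj₁ a≰d    = a≰d a≤d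
  ...   | inj₂ refined = m<n⇒n≢0 (Refined⇒k₂>0 bc) k≡0
    where
    bc : Refined b c
    bc = Refined-closed a≺c b≺c b≺d a≢b d≢c a≤d (Sum.map k₂>0⇒Refined k₂>0⇒Refined refined)

  SubNDiag-mono : ∀ {k k′ b c} → (∀ {x y} → x ≺ y → 0 < k x y → 0 < k′ x y) → k′ b c ≡ 0 →
                  SubNDiag k b c → SubNDiag k′ b c
  SubNDiag-mono k⇒k′ k′≡0 (b≺c , _ , a , d , a≺c , b≺d , a≢b , d≢c , a≰d⊎subdivided) =
    b≺c , k′≡0 , a , d , a≺c , b≺d , a≢b , d≢c , Sum.map₂ (Sum.map (k⇒k′ a≺c) (k⇒k′ b≺d)) a≰d⊎subdivided

  grow-minimal : ∀ {k k′} → NFree (Sub P k′) → (∀ {x y} → x ≺ y → 0 < k x y → 0 < k′ x y) →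
                 ∀ {x y} → x ≺ y → 0 < grow k x y → 0 < k′ x y
  grow-minimal {k′ = k′} nf k⇒k′ {x} {y} x≺y g>0 with 0 <? k′ x y | grow>0⇒ g>0
  ... | yes k′>0 | _          = k′>0
  ... | no _     | inj₁ k>0   = k⇒k′ x≺y k>0
  ... | no k′≯0  | inj₂ subN  =
    ⊥-elim (NFree⇒¬NDiag nf (Subdivision.SubNDiag⇒NDiag k′ (SubNDiag-mono k⇒k′ (≮0⇒≡0 k′≯0) subN)))

  SN-P≅ : SN P ≅ Sub P k₁
  SN-P≅ = ≅-trans (SN-cong P≅Sub₀) (SN-Sub.SN-Sub≅ k₀ λ _ _ → z≤n)

  SN-SN-P≅ : SN (SN P) ≅ Sub P k₂
  SN-SN-P≅ = ≅-trans (SN-cong SN-P≅) (SN-Sub.SN-Sub≅ k₁ λ x y → indicator≤1 (growth? k₀ x y))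

theorem1 : (n : ℕ) (_≤_ : Rel (Fin n) 0ℓ) → IsDecPartialOrder _≡_ _≤_ →
    NFree (SN (SN (FinPoset n _≤_)))
    × Σ (Fin n → Fin n → ℕ) (λ k →
        Σ (SNVert (SN (FinPoset n _≤_)) ↔ SubVert (FinPoset n _≤_) k) (λ f →
          (∀ x → Inverse.to f (old (old x)) ≡ old x)
          × (∀ u v → OrdStr._≤_ (SN (SN (FinPoset n _≤_))) u v
                   ⇔ OrdStr._≤_ (Sub (FinPoset n _≤_) k) (Inverse.to f u) (Inverse.to f v)))
        × (∀ (k′ : Fin n → Fin n → ℕ) → NFree (Sub (FinPoset n _≤_) k′) →
             ∀ x y → Covers (FinPoset n _≤_) x y → 0 < k x y → 0 < k′ x y))
theorem1 n _≤_ po =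
  NFree-reflect SN-SN-P≅ (Subdivision.NFree-Sub k₂ λ _ _ → ¬SubNDiag-k₂) ,
  k₂ , (_≅_.bijection SN-SN-P≅ , (λ _ → refl) , _≅_.order SN-SN-P≅) ,
  λ k′ nf x y x≺y → grow-minimal {k₁} nf (grow-minimal {k₀} nf λ _ ()) x≺y
  where open FinitePoset n _≤_ po
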